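{- Let $\mathcal{U}$ be a set of strongly meaningless terms. If $t\leadsto_{N_\mathcal{U}} s_1$ and $t\leadsto_{N_\mathcal{U}} s_2$, then $s_1\equiv s_2$.
   Context: Infinitary lambda terms $\Lambda^\infty$ are the finite and infinite terms generated coinductively by $\Lambda^\infty ::= C \mid V \mid \Lambda^\infty\Lambda^\infty \mid \lambda V.\Lambda^\infty$, where $V$ is an infinite set of variables and $C$ a set of constants disjoint from $V$ containing a distinguished constant $\bot$; atoms are variables or constants; terms are taken modulo renaming of bound variables, $s[t/x]$ is capture-avoiding substitution; $\equiv$ is identity of terms. $\to_\beta$ is the compatible closure (closure under application on either side and under $\lambda$) of $\{((\lambda x.s)t,s[t/x])\}$, $\to^*_\beta$ its reflexive-transitive closure, and $\to^\infty_\beta$ is defined coinductively: $s\to^\infty_\beta a$ if $s\to^*_\beta a$ ($a$ an atom); $s\to^\infty_\beta t_1't_2'$ if $s\to^*_\beta t_1t_2$ and $t_i\to^\infty_\beta t_i'$; $s\to^\infty_\beta\lambda x.r'$ if $s\to^*_\beta\lambda x.r$ and $r\to^\infty_\beta r'$. Weak head reduction $\to_w$: $(\lambda x.s)t\to_w s[t/x]$, and $st\to_w s't$ if $s\to_w s'$. A term $t$ is in root normal form (rnf) if $t\equiv a$ with $a\not\equiv\bot$ an atom, or $t\equiv\lambda x.t'$, or $t\equiv t_1t_2$ with no $s$ such that $t_1\to^*_\beta\lambda x.s$; $\mathcal{R}$ is the set of root-active terms, i.e. $t$ with no $t'$ in rnf such that $t\to^\infty_\beta t'$. For $t\notin\mathcal{R}$,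 $\mathrm{crnf}(t)$ is the rnf reached by the shortest weak head reduction $t\to^*_w s$ with $s$ in rnf (it exists and is unique). The parallel closure $\Rightarrow_R$ of a relation $R$ is coinductively: $s\Rightarrow_R t$ if $(s,t)\in R$; $a\Rightarrow_R a$; $s_1s_2\Rightarrow_R t_1t_2$ if $s_i\Rightarrow_R t_i$; $\lambda x.s\Rightarrow_R\lambda x.s'$ if $s\Rightarrow_R s'$; $\sim_\mathcal{U}$ is the parallel closure of $\mathcal{U}\times\mathcal{U}$. $\mathcal{U}$ is meaningless if: (closure) $t\in\mathcal{U}$, $t\to^\infty_\beta s\Rightarrow s\in\mathcal{U}$; (substitution) $t\in\mathcal{U}\Rightarrow t[s/x]\in\mathcal{U}$; (overlap) $\lambda x.s\in\mathcal{U}\Rightarrow(\lambda x.s)t\in\mathcal{U}$; (root-activeness) $\mathcal{R}\subseteq\mathcal{U}$; (indiscernibility) $t\in\mathcal{U}$, $t\sim_\mathcal{U}s\Rightarrow s\in\mathcal{U}$; strongly meaningless if also (expansion) $t\in\mathcal{U}$, $s\to^\infty_\beta t\Rightarrow s\in\mathcal{U}$. $\leadsto_{N_\mathcal{U}}$ is defined coinductively by: $t\leadsto_{N_\mathcal{U}}\bot$ if $t\in\mathcal{U}$; $t\leadsto_{N_\mathcal{U}}a$ if $t\notin\mathcal{U}$ and $\mathrm{crnf}(t)\equiv a$; $t\leadsto_{N_\mathcal{U}}s_1s_2$ if $t\notin\mathcal{U}$, $\mathrm{crnf}(t)\equiv t_1t_2$, $t_i\leadsto_{N_\mathcal{U}}s_i$;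 $t\leadsto_{N_\mathcal{U}}\lambda x.s$ if $t\notin\mathcal{U}$, $\mathrm{crnf}(t)\equiv\lambda x.t'$, $t'\leadsto_{N_\mathcal{U}}s$. -}

-- Infinite terms are a coinductive record type; all
-- coinductively defined relations are encoded as greatest fixed points
-- (union of post-fixed points, Knaster–Tarski) of monotone one-step
-- operators.  Variables are de Bruijn indices (terms modulo α).
module Defs where

open import Level using (Level; _⊔_) renaming (suc to lsuc; zero to lzero)
open import Data.Nat using (ℕ; zero; suc; _≤_; _<_; _+_; _∸_; _≡ᵇ_)
open import Data.Bool using (if_then_else_)
open import Data.Product using (Σ; ∃; _×_; _,_)
open import Relation.Nullary using (¬_)
open import Relation.Binary.PropositionalEquality using (_≡_)

ν : {ℓ : Level} {I : Set} → ((I → Set ℓ) → (I → Set ℓ)) → I → Set (lsuc ℓ)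
ν {ℓ} {I} F i = Σ (I → Set ℓ) λ R → (∀ {j} → R j → F R j) × R i

module _ {C : Set} where

  mutual
    data Term : Set where
      var : ℕ → Term
      con : C → Term
      app : ∞Term → ∞Term → Term
      lam : ∞Term → Term

    record ∞Term : Set where
      coinductive
      field force : Term

  open ∞Term public

  -- Identity of terms (≡ in the paper): bisimilarity

  data ≈Step (R : Term × Term → Set) : Term × Term → Set where
    ≈var : ∀ {n} → ≈Step R (var n , var n)
    ≈con : ∀ {c} → ≈Step R (con c , con c)
    ≈app : ∀ {s₁ s₂ t₁ t₂} → R (force s₁ , force t₁) → R (force s₂ , force t₂) →
           ≈Step R (app s₁ s₂ , app t₁ t₂)
    ≈lam : ∀ {s t} → R (force s , force t) → ≈Step R (lam s , lam t)

  _≈_ : Term → Term → Set₁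
  s ≈ t = ν ≈Step (s , t)

  -- Capture-avoiding substitution, as a (functional) relation.
  -- Mode sub d     : applying σ under d binders
  -- Mode shift c k : shifting free indices (≥ c) by k

  data Mode : Set where
    sub   : ℕ → Mode
    shift : ℕ → ℕ → Mode

  up : Mode → Mode
  up (sub d) = sub (suc d)
  up (shift c k) = shift (suc c) k

  data SubStep (σ : ℕ → Term) (R : Mode × Term × Term → Set) :
               Mode × Term × Term → Set where
    s-var< : ∀ {d n} → n < d → SubStep σ R (sub d , var n , var n)
    s-var≥ : ∀ {d n u} → d ≤ n → R (shift 0 d , σ (n ∸ d) , u) →
             SubStep σ R (sub d , var n , u)
    h-var< : ∀ {c k n} → n < c → SubStep σ R (shift c k , var n , var n)
    h-var≥ : ∀ {c k n} → c ≤ n → SubStep σ R (shift c k , var n , var (n + k))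
    s-con  : ∀ {m a} → SubStep σ R (m , con a , con a)
    s-app  : ∀ {m a b a' b'} → R (m , force a , force a') → R (m , force b , force b') →
             SubStep σ R (m , app a b , app a' b')
    s-lam  : ∀ {m a a'} → R (up m , force a , force a') →
             SubStep σ R (m , lam a , lam a')

  Subst : (ℕ → Term) → Term → Term → Set₁
  Subst σ t u = ν (SubStep σ) (sub 0 , t , u)

  -- Subst₀ t s u : u ≡ s[t/x], x the variable bound by λx.s (index 0)
  Subst₀ : Term → Term → Term → Set₁
  Subst₀ t s u = Subst (λ { zero → t ; (suc n) → var n }) s u

  SubstFree : ℕ → Term → Term → Term → Set₁
  SubstFree x s t u = Subst (λ m → if m ≡ᵇ x then s else var m) t u

  data _→β_ : Term → Term → Set₁ where
    β    : ∀ {f t r u} → force f ≡ lam r → Subst₀ (force t) (force r) u →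
           app f t →β u
    appL : ∀ {s s' t} → force s →β force s' → app s t →β app s' t
    appR : ∀ {s t t'} → force t →β force t' → app s t →β app s t'
    lamξ : ∀ {s s'} → force s →β force s' → lam s →β lam s'

  data _→β*_ : Term → Term → Set₁ where
    ε   : ∀ {t} → t →β* t
    _◅_ : ∀ {t u v} → t →β u → u →β* v → t →β* v

  data ∞Step (R : Term × Term → Set₁) : Term × Term → Set₁ where
    ∞var : ∀ {s n} → s →β* var n → ∞Step R (s , var n)
    ∞con : ∀ {s c} → s →β* con c → ∞Step R (s , con c)
    ∞app : ∀ {s t₁ t₂ t₁' t₂'} → s →β* app t₁ t₂ →
           R (force t₁ , force t₁') → R (force t₂ , force t₂') →
           ∞Step R (s , app t₁' t₂')
    ∞lam : ∀ {s r r'} → s →β* lam r → R (force r , force r') →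
           ∞Step R (s , lam r')

  _→∞_ : Term → Term → Set₂
  s →∞ t = ν ∞Step (s , t)

  data _→w_ : Term → Term → Set₁ where
    wβ   : ∀ {f t r u} → force f ≡ lam r → Subst₀ (force t) (force r) u →
           app f t →w u
    wapp : ∀ {s s' t} → force s →w force s' → app s t →w app s' t

  data _→w[_]_ : Term → ℕ → Term → Set₁ where
    done : ∀ {t} → t →w[ zero ] t
    step : ∀ {t u v n} → t →w u → u →w[ n ] v → t →w[ suc n ] v

  -- Root normal forms (⊥c is the distinguished constant ⊥)

  data RNF (⊥c : C) : Term → Set₁ where
    rvar : ∀ {n} → RNF ⊥c (var n)
    rcon : ∀ {c} → ¬ (c ≡ ⊥c) → RNF ⊥c (con c)
    rlam : ∀ {r} → RNF ⊥c (lam r)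
    rapp : ∀ {t₁ t₂} → ¬ (∃ λ r → force t₁ →β* lam r) → RNF ⊥c (app t₁ t₂)

  RootActive : C → Term → Set₂
  RootActive ⊥c t = ¬ (∃ λ t' → RNF ⊥c t' × t →∞ t')

  CRNF : C → Term → Term → Set₁
  CRNF ⊥c t s = Σ ℕ λ n → t →w[ n ] s × RNF ⊥c s ×
                (∀ m s' → t →w[ m ] s' → RNF ⊥c s' → n ≤ m)

  data ParStep (R₀ : Term → Term → Set) (R : Term × Term → Set) :
               Term × Term → Set where
    pR   : ∀ {s t} → R₀ s t → ParStep R₀ R (s , t)
    pvar : ∀ {n} → ParStep R₀ R (var n , var n)
    pcon : ∀ {c} → ParStep R₀ R (con c , con c)
    papp : ∀ {s₁ s₂ t₁ t₂} → R (force s₁ , force t₁) → R (force s₂ , force t₂) →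
           ParStep R₀ R (app s₁ s₂ , app t₁ t₂)
    plam : ∀ {s s'} → R (force s , force s') → ParStep R₀ R (lam s , lam s')

  Par : (Term → Term → Set) → Term → Term → Set₁
  Par R₀ s t = ν (ParStep R₀) (s , t)

  _∼[_]_ : Term → (Term → Set) → Term → Set₁
  s ∼[ U ] t = Par (λ a b → U a × U b) s t

  record Meaningless (⊥c : C) (U : Term → Set) : Set₂ where
    field
      closure          : ∀ {t s} → U t → t →∞ s → U s
      substitution     : ∀ {t u} x s → U t → SubstFree x s t u → U u
      overlapping      : ∀ {f s t} → force f ≡ lam s → U (lam s) → U (app f t)
      root-activeness  : ∀ {t} → RootActive ⊥c t → U t
      indiscernibility : ∀ {t s} → U t → t ∼[ U ] s → U s

  record StronglyMeaningless (⊥c : C) (U : Term → Set) : Set₂ where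
    field
      meaningless : Meaningless ⊥c U
      expansion   : ∀ {s t} → U t → s →∞ t → U s

  data NFStep (⊥c : C) (U : Term → Set) (R : Term × Term → Set₁) :
              Term × Term → Set₁ where
    n⊥   : ∀ {t} → U t → NFStep ⊥c U R (t , con ⊥c)
    nvar : ∀ {t n} → ¬ U t → CRNF ⊥c t (var n) → NFStep ⊥c U R (t , var n)
    ncon : ∀ {t c} → ¬ U t → CRNF ⊥c t (con c) → NFStep ⊥c U R (t , con c)
    napp : ∀ {t t₁ t₂ s₁ s₂} → ¬ U t → CRNF ⊥c t (app t₁ t₂) →
           R (force t₁ , force s₁) → R (force t₂ , force s₂) →
           NFStep ⊥c U R (t , app s₁ s₂)
    nlam : ∀ {t t' s} → ¬ U t → CRNF ⊥c t (lam t') → R (force t' , force s) →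
           NFStep ⊥c U R (t , lam s)

  _⇝N[_,_]_ : Term → C → (Term → Set) → Term → Set₂
  t ⇝N[ ⊥c , U ] s = ν (NFStep ⊥c U) (t , s)

-- Terms are infinite, so "identity" is bisimilarity and everything must be
-- shown to respect it.  Substitution, β-reduction, root normal forms and weak
-- head reduction all do; since weak head reduction is deterministic up to
-- bisimilarity, the crnf of bisimilar terms are bisimilar.  Two derivations
-- of t ⇝N s₁ and t ⇝N s₂ therefore make the same choice at every node: both
-- put ⊥ exactly when the current subterm is in U (U is closed under
-- bisimilarity by indiscernibility), and otherwise both copy the head of the
-- same crnf and recurse into bisimilar subterms.
module Submission where

open import Defs
open import Data.Nat using (ℕ; zero; suc; _≤_; _∸_)
open import Data.Nat.Properties using (<⇒≱; ≤-pred)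
open import Data.Maybe using (just; nothing; maybe′)
open import Data.Product using (Σ; ∃; ∃₂; _×_; _,_; proj₁; proj₂)
open import Data.Sum using (_⊎_; inj₁; inj₂)
open import Data.Unit using (⊤; tt)
open import Data.Empty using (⊥; ⊥-elim)
open import Relation.Nullary using (¬_)
open import Relation.Binary.PropositionalEquality using (_≡_; refl; subst; subst₂)

module _ {C : Set} where

  private
    Tm : Set
    Tm = Term {C}

    ∞Tm : Set
    ∞Tm = ∞Term {C}

    Pair : Set
    Pair = Tm × Tm

    box : Tm → ∞Tm
    force (box z) = z

  SameHead : Pair → Set
  SameHead = ≈Step (λ _ → ⊤)

  data _◃_ : Pair → Pair → Set where
    appˡ : ∀ {a b c d} → (force a , force c) ◃ (app a b , app c d)
    appʳ : ∀ {a b c d} → (force b , force d) ◃ (app a b , app c d)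
    lamᵇ : ∀ {a c} → (force a , force c) ◃ (lam a , lam c)

  data Reachable (p : Pair) : Pair → Set where
    here  : Reachable p p
    there : ∀ {q r} → Reachable p q → r ◃ q → Reachable p r

  -- _≈_ only accepts small bisimulations; a large one (typically mentioning
  -- _≈_ itself) is cut down to the pairs reachable from the starting pair.
  ≈-coinduction : ∀ {ℓ} (R : Pair → Set ℓ) →
                  (∀ {p} → R p → SameHead p) → (∀ {p q} → R p → q ◃ p → R q) →
                  ∀ {a b} → R (a , b) → a ≈ b
  ≈-coinduction R head child {a} {b} r = Reachable (a , b) , post , here
    where
    holds : ∀ {q} → Reachable (a , b) q → R q
    holds here = r
    holds (there reach q◃) = child (holds reach) q◃

    post : ∀ {q} → Reachable (a , b) q → ≈Step (Reachable (a , b)) q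
    post reach with head (holds reach)
    ... | ≈var = ≈var
    ... | ≈con = ≈con
    ... | ≈app _ _ = ≈app (there reach appˡ) (there reach appʳ)
    ... | ≈lam _ = ≈lam (there reach lamᵇ)

  ≈-head : ∀ {a b : Tm} → a ≈ b → SameHead (a , b)
  ≈-head (R , post , r) with post r
  ... | ≈var = ≈var
  ... | ≈con = ≈con
  ... | ≈app _ _ = ≈app tt tt
  ... | ≈lam _ = ≈lam tt

  ≈-child : ∀ {a b c d : Tm} → a ≈ b → (c , d) ◃ (a , b) → c ≈ d
  ≈-child (R , post , r) q◃ with post r | q◃
  ... | ≈app r₁ _ | appˡ = R , post , r₁
  ... | ≈app _ r₂ | appʳ = R , post , r₂
  ... | ≈lam r₁ | lamᵇ = R , post , r₁

  sameHead-refl : (a : Tm) → SameHead (a , a)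
  sameHead-refl (var _) = ≈var
  sameHead-refl (con _) = ≈con
  sameHead-refl (app _ _) = ≈app tt tt
  sameHead-refl (lam _) = ≈lam tt

  sameHead-sym : ∀ {a b : Tm} → SameHead (a , b) → SameHead (b , a)
  sameHead-sym ≈var = ≈var
  sameHead-sym ≈con = ≈con
  sameHead-sym (≈app _ _) = ≈app tt tt
  sameHead-sym (≈lam _) = ≈lam tt

  sameHead-trans : ∀ {a b c : Tm} → SameHead (a , b) → SameHead (b , c) → SameHead (a , c)
  sameHead-trans ≈var ≈var = ≈var
  sameHead-trans ≈con ≈con = ≈con
  sameHead-trans (≈app _ _) (≈app _ _) = ≈app tt tt
  sameHead-trans (≈lam _) (≈lam _) = ≈lam tt

  ◃-swap : ∀ {a b c d : Tm} → (c , d) ◃ (a , b) → (d , c) ◃ (b , a)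
  ◃-swap appˡ = appˡ
  ◃-swap appʳ = appʳ
  ◃-swap lamᵇ = lamᵇ

  ≈-refl : ∀ {a : Tm} → a ≈ a
  ≈-refl = ≈-coinduction (λ p → proj₁ p ≡ proj₂ p) head child refl
    where
    head : ∀ {p} → proj₁ p ≡ proj₂ p → SameHead p
    head {a , _} refl = sameHead-refl a

    child : ∀ {p q} → proj₁ p ≡ proj₂ p → q ◃ p → proj₁ q ≡ proj₂ q
    child refl appˡ = refl
    child refl appʳ = refl
    child refl lamᵇ = refl

  ≈-sym : ∀ {a b : Tm} → a ≈ b → b ≈ a
  ≈-sym = ≈-coinduction (λ p → proj₂ p ≈ proj₁ p) (λ e → sameHead-sym (≈-head e)) child
    where
    child : ∀ {p q} → proj₂ p ≈ proj₁ p → q ◃ p → proj₂ q ≈ proj₁ q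
    child {q = _ , _} e q◃ = ≈-child e (◃-swap q◃)

  ≈-fold : ∀ {a b : Tm} → SameHead (a , b) → (∀ {c d} → (c , d) ◃ (a , b) → c ≈ d) → a ≈ b
  ≈-fold {a} {b} h children = ≈-coinduction R head child (inj₁ refl)
    where
    R : Pair → Set₁
    R p = p ≡ (a , b) ⊎ proj₁ p ≈ proj₂ p

    head : ∀ {p} → R p → SameHead p
    head (inj₁ refl) = h
    head (inj₂ e) = ≈-head e

    child : ∀ {p q} → R p → q ◃ p → R q
    child {q = _ , _} (inj₁ refl) q◃ = inj₂ (children q◃)
    child {q = _ , _} (inj₂ e) q◃ = inj₂ (≈-child e q◃)

  app-cong : ∀ {a b c d : ∞Tm} → force a ≈ force c → force b ≈ force d → app a b ≈ app c d
  app-cong e₁ e₂ = ≈-fold (≈app tt tt) λ { appˡ → e₁ ; appʳ → e₂ }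

  lam-cong : ∀ {a c : ∞Tm} → force a ≈ force c → lam a ≈ lam c
  lam-cong e = ≈-fold (≈lam tt) λ { lamᵇ → e }

  ≈app-inv : ∀ {x : Tm} {g s} → x ≈ app g s →
             ∃₂ λ a b → x ≡ app a b × force a ≈ force g × force b ≈ force s
  ≈app-inv e with ≈-head e
  ... | ≈app _ _ = _ , _ , refl , ≈-child e appˡ , ≈-child e appʳ

  ≈lam-inv : ∀ {x : Tm} {r} → x ≈ lam r → ∃ λ a → x ≡ lam a × force a ≈ force r
  ≈lam-inv e with ≈-head e
  ... | ≈lam _ = _ , refl , ≈-child e lamᵇ

  IsBisimulation : (Pair → Set) → Set
  IsBisimulation B = ∀ {p} → B p → ≈Step B p

  ≈-family : ∀ {I : Set} {a b : I → Tm} → (∀ i → a i ≈ b i) →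
             Σ (Pair → Set) λ B → IsBisimulation B × (∀ i → B (a i , b i))
  ≈-family {I} e = B , post , λ i → i , proj₂ (proj₂ (e i))
    where
    B : Pair → Set
    B p = Σ I λ i → proj₁ (e i) p

    tag : ∀ i {p} → ≈Step (proj₁ (e i)) p → ≈Step B p
    tag i ≈var = ≈var
    tag i ≈con = ≈con
    tag i (≈app r₁ r₂) = ≈app (i , r₁) (i , r₂)
    tag i (≈lam r) = ≈lam (i , r)

    post : IsBisimulation B
    post (i , r) = tag i (proj₁ (proj₂ (e i)) r)

  Subst-resp-≈ : ∀ {σ σ′ : ℕ → Tm} {x x′ u} → (∀ n → σ′ n ≈ σ n) → x′ ≈ x →
                 Subst σ x u → Subst σ′ x′ u
  Subst-resp-≈ {σ} {σ′} {x} {x′} eσ ex (S , postS , s)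
    with ≈-family {a = maybe′ σ′ x′} {b = maybe′ σ x} (λ { (just n) → eσ n ; nothing → ex })
  ... | B , postB , inB = R , post , (x , s , inB nothing)
    where
    R : Mode × Tm × Tm → Set
    R (m , a′ , v) = Σ Tm λ a → S (m , a , v) × B (a′ , a)

    go : ∀ {m a′ a v} → SubStep σ S (m , a , v) → ≈Step B (a′ , a) → SubStep σ′ R (m , a′ , v)
    go (s-var< lt) ≈var = s-var< lt
    go (s-var≥ {d} {n} le s) ≈var = s-var≥ le (_ , s , inB (just (n ∸ d)))
    go (h-var< lt) ≈var = h-var< lt
    go (h-var≥ le) ≈var = h-var≥ le
    go s-con ≈con = s-con
    go (s-app s₁ s₂) (≈app b₁ b₂) = s-app (_ , s₁ , b₁) (_ , s₂ , b₂)
    go (s-lam s₁) (≈lam b₁) = s-lam (_ , s₁ , b₁)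

    post : ∀ {j} → R j → SubStep σ′ R j
    post (_ , s , b) = go (postS s) (postB b)

  Subst-functional-≈ : ∀ {σ σ′ : ℕ → Tm} {x x′ u u′} → (∀ n → σ n ≈ σ′ n) → x ≈ x′ →
                       Subst σ x u → Subst σ′ x′ u′ → u ≈ u′
  Subst-functional-≈ {σ} {σ′} {x} {x′} eσ ex (S₁ , post₁ , s₁) (S₂ , post₂ , s₂)
    with ≈-family {a = maybe′ σ x} {b = maybe′ σ′ x′} (λ { (just n) → eσ n ; nothing → ex })
  ... | B , postB , inB = R , post , (sub 0 , x , x′ , s₁ , s₂ , inB nothing)
    where
    R : Pair → Set
    R (v , v′) = Σ Mode λ m → Σ Tm λ a → Σ Tm λ a′ →
                 S₁ (m , a , v) × S₂ (m , a′ , v′) × B (a , a′)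

    -- The shift mode needs its own function: the s-var≥ case below passes
    -- from sub to shift mode without any structural decrease.
    goShift : ∀ {c k a a′ v v′} → SubStep σ S₁ (shift c k , a , v) →
              SubStep σ′ S₂ (shift c k , a′ , v′) → ≈Step B (a , a′) → ≈Step R (v , v′)
    goShift (h-var< _) (h-var< _) ≈var = ≈var
    goShift (h-var< lt) (h-var≥ le) ≈var = ⊥-elim (<⇒≱ lt le)
    goShift (h-var≥ le) (h-var< lt) ≈var = ⊥-elim (<⇒≱ lt le)
    goShift (h-var≥ _) (h-var≥ _) ≈var = ≈var
    goShift s-con s-con ≈con = ≈con
    goShift (s-app p q) (s-app p′ q′) (≈app b₁ b₂) =
      ≈app (_ , _ , _ , p , p′ , b₁) (_ , _ , _ , q , q′ , b₂)
    goShift (s-lam p) (s-lam p′) (≈lam b₁) = ≈lam (_ , _ , _ , p , p′ , b₁)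

    go : ∀ {m a a′ v v′} → SubStep σ S₁ (m , a , v) → SubStep σ′ S₂ (m , a′ , v′) →
         ≈Step B (a , a′) → ≈Step R (v , v′)
    go (s-var< _) (s-var< _) ≈var = ≈var
    go (s-var< lt) (s-var≥ le _) ≈var = ⊥-elim (<⇒≱ lt le)
    go (s-var≥ le _) (s-var< lt) ≈var = ⊥-elim (<⇒≱ lt le)
    go (s-var≥ {d} {n} _ s) (s-var≥ _ s′) ≈var =
      goShift (post₁ s) (post₂ s′) (postB (inB (just (n ∸ d))))
    go (h-var< _) (h-var< _) ≈var = ≈var
    go (h-var< lt) (h-var≥ le) ≈var = ⊥-elim (<⇒≱ lt le)
    go (h-var≥ le) (h-var< lt) ≈var = ⊥-elim (<⇒≱ lt le)
    go (h-var≥ _) (h-var≥ _) ≈var = ≈var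
    go s-con s-con ≈con = ≈con
    go (s-app p q) (s-app p′ q′) (≈app b₁ b₂) =
      ≈app (_ , _ , _ , p , p′ , b₁) (_ , _ , _ , q , q′ , b₂)
    go (s-lam p) (s-lam p′) (≈lam b₁) = ≈lam (_ , _ , _ , p , p′ , b₁)

    post : ∀ {j} → R j → ≈Step R j
    post (_ , _ , _ , s , s′ , b) = go (post₁ s) (post₂ s′) (postB b)

  Subst₀-resp-≈ : ∀ {t t′ r r′ u : Tm} → t′ ≈ t → r′ ≈ r → Subst₀ t r u → Subst₀ t′ r′ u
  Subst₀-resp-≈ et er = Subst-resp-≈ (λ { zero → et ; (suc _) → ≈-refl }) er

  Subst₀-functional-≈ : ∀ {t t′ r r′ u u′ : Tm} → t ≈ t′ → r ≈ r′ →
                        Subst₀ t r u → Subst₀ t′ r′ u′ → u ≈ u′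
  Subst₀-functional-≈ et er = Subst-functional-≈ (λ { zero → et ; (suc _) → ≈-refl }) er

  →β-simulation : ∀ {x y z : Tm} → x ≈ y → y →β z → ∃ λ z′ → x →β z′ × z′ ≈ z
  →β-simulation e (β eq s) with ≈app-inv e
  ... | a , b , refl , ea , eb with ≈lam-inv (subst (force a ≈_) eq ea)
  ...   | _ , eqa , er = _ , β eqa (Subst₀-resp-≈ eb er s) , ≈-refl
  →β-simulation e (appL st) with ≈app-inv e
  ... | a , b , refl , ea , eb with →β-simulation ea st
  ...   | z′ , st′ , ez = app (box z′) b , appL st′ , app-cong ez eb
  →β-simulation e (appR st) with ≈app-inv e
  ... | a , b , refl , ea , eb with →β-simulation eb st
  ...   | z′ , st′ , ez = app a (box z′) , appR st′ , app-cong ea ez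
  →β-simulation e (lamξ st) with ≈lam-inv e
  ... | a , refl , ea with →β-simulation ea st
  ...   | z′ , st′ , ez = lam (box z′) , lamξ st′ , lam-cong ez

  →β*-simulation : ∀ {x y z : Tm} → x ≈ y → y →β* z → ∃ λ z′ → x →β* z′ × z′ ≈ z
  →β*-simulation e ε = _ , ε , e
  →β*-simulation e (st ◅ sts) with →β-simulation e st
  ... | _ , st′ , e′ with →β*-simulation e′ sts
  ...   | z″ , sts′ , e″ = z″ , st′ ◅ sts′ , e″

  →β*-lam-reflect : ∀ {x y : Tm} {r} → x ≈ y → y →β* lam r → ∃ λ r′ → x →β* lam r′
  →β*-lam-reflect e red with →β*-simulation e red
  ... | _ , red′ , ez with ≈lam-inv ez
  ...   | r′ , refl , _ = r′ , red′

  RNF-resp-≈ : ∀ {⊥c : C} {a b : Tm} → a ≈ b → RNF ⊥c a → RNF ⊥c b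
  RNF-resp-≈ e rnf with ≈-head e | rnf
  ... | ≈var | rvar = rvar
  ... | ≈con | rcon c≢⊥ = rcon c≢⊥
  ... | ≈lam _ | rlam = rlam
  ... | ≈app _ _ | rapp no-lam =
    rapp λ (_ , red) → no-lam (→β*-lam-reflect (≈-child e appˡ) red)

  ↛w-≈lam : ∀ {x y : Tm} {r} → x ≈ lam r → x →w y → ⊥
  ↛w-≈lam e (wβ _ _) with ≈-head e
  ... | ()
  ↛w-≈lam e (wapp _) with ≈-head e
  ... | ()

  →w-deterministic-≈ : ∀ {x y x′ y′ : Tm} → x ≈ y → x →w x′ → y →w y′ → x′ ≈ y′
  →w-deterministic-≈ e (wβ eq s) (wβ eq′ s′) =
    Subst₀-functional-≈ (≈-child e appʳ) (≈-child (subst₂ _≈_ eq eq′ (≈-child e appˡ)) lamᵇ) s s′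
  →w-deterministic-≈ e (wβ eq _) (wapp w) =
    ⊥-elim (↛w-≈lam (subst (_ ≈_) eq (≈-sym (≈-child e appˡ))) w)
  →w-deterministic-≈ e (wapp w) (wβ eq _) =
    ⊥-elim (↛w-≈lam (subst (_ ≈_) eq (≈-child e appˡ)) w)
  →w-deterministic-≈ e (wapp w) (wapp w′) =
    app-cong (→w-deterministic-≈ (≈-child e appˡ) w w′) (≈-child e appʳ)

  NoShorterRNF : C → Tm → ℕ → Set₁
  NoShorterRNF ⊥c x n = ∀ k s → x →w[ k ] s → RNF ⊥c s → n ≤ k

  noShorterRNF-step : ∀ {⊥c : C} {x x′ n} → NoShorterRNF ⊥c x (suc n) → x →w x′ →
                      NoShorterRNF ⊥c x′ n
  noShorterRNF-step shortest w k s red rnf = ≤-pred (shortest (suc k) s (step w red) rnf)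

  shortestRNF-≈ : ∀ {⊥c : C} {x y A B : Tm} {n m} → x ≈ y →
                  x →w[ n ] A → RNF ⊥c A → NoShorterRNF ⊥c x n →
                  y →w[ m ] B → RNF ⊥c B → NoShorterRNF ⊥c y m → A ≈ B
  shortestRNF-≈ e done _ _ done _ _ = e
  shortestRNF-≈ e done rnfA _ (step _ _) _ shortestB
    with () ← shortestB 0 _ done (RNF-resp-≈ e rnfA)
  shortestRNF-≈ e (step _ _) _ shortestA done rnfB _
    with () ← shortestA 0 _ done (RNF-resp-≈ (≈-sym e) rnfB)
  shortestRNF-≈ e (step w redA) rnfA shortestA (step w′ redB) rnfB shortestB =
    shortestRNF-≈ (→w-deterministic-≈ e w w′)
      redA rnfA (noShorterRNF-step shortestA w) redB rnfB (noShorterRNF-step shortestB w′)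

  CRNF-unique-≈ : ∀ {⊥c : C} {t t′ A B : Tm} → t ≈ t′ → CRNF ⊥c t A → CRNF ⊥c t′ B → A ≈ B
  CRNF-unique-≈ e (_ , redA , rnfA , shortestA) (_ , redB , rnfB , shortestB) =
    shortestRNF-≈ e redA rnfA shortestA redB rnfB shortestB

  ≈⇒Par : ∀ {R₀ : Tm → Tm → Set} {a b : Tm} → a ≈ b → Par R₀ a b
  ≈⇒Par (R , post , r) = R , (λ r → asPar (post r)) , r
    where
    asPar : ∀ {R₀ p} → ≈Step R p → ParStep R₀ R p
    asPar ≈var = pvar
    asPar ≈con = pcon
    asPar (≈app r₁ r₂) = papp r₁ r₂
    asPar (≈lam r₁) = plam r₁

  Meaningless-resp-≈ : ∀ {⊥c : C} {U : Tm → Set} → Meaningless ⊥c U →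
                       ∀ {a b} → U a → a ≈ b → U b
  Meaningless-resp-≈ M u e = Meaningless.indiscernibility M u (≈⇒Par e)

  NFStep-view : ∀ {⊥c : C} {U : Tm → Set} {R : Pair → Set₁} {t x} → NFStep ⊥c U R (t , x) →
                (U t × x ≡ con ⊥c) ⊎ (¬ U t × ∃ λ c → CRNF ⊥c t c × SameHead (c , x))
  NFStep-view (n⊥ u) = inj₁ (u , refl)
  NFStep-view (nvar u∌t crnf) = inj₂ (u∌t , _ , crnf , ≈var)
  NFStep-view (ncon u∌t crnf) = inj₂ (u∌t , _ , crnf , ≈con)
  NFStep-view (napp u∌t crnf _ _) = inj₂ (u∌t , _ , crnf , ≈app tt tt)
  NFStep-view (nlam u∌t crnf _) = inj₂ (u∌t , _ , crnf , ≈lam tt)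

  NFStep-sameHead : ∀ {⊥c : C} {U : Tm → Set} {R₁ R₂ : Pair → Set₁} {a b x y} →
                    Meaningless ⊥c U → a ≈ b →
                    NFStep ⊥c U R₁ (a , x) → NFStep ⊥c U R₂ (b , y) → SameHead (x , y)
  NFStep-sameHead M e nf₁ nf₂ with NFStep-view nf₁ | NFStep-view nf₂
  ... | inj₁ (_ , refl) | inj₁ (_ , refl) = ≈con
  ... | inj₁ (u , _) | inj₂ (u∌b , _) = ⊥-elim (u∌b (Meaningless-resp-≈ M u e))
  ... | inj₂ (u∌a , _) | inj₁ (u , _) = ⊥-elim (u∌a (Meaningless-resp-≈ M u (≈-sym e)))
  ... | inj₂ (_ , _ , crnf₁ , h₁) | inj₂ (_ , _ , crnf₂ , h₂) =
    sameHead-trans (sameHead-sym h₁) (sameHead-trans (≈-head (CRNF-unique-≈ e crnf₁ crnf₂)) h₂)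

  JointlyRelated : (Pair → Set₁) → (Pair → Set₁) → Pair → Set₁
  JointlyRelated R₁ R₂ (x , y) = ∃₂ λ a b → a ≈ b × R₁ (a , x) × R₂ (b , y)

  NFStep-child : ∀ {⊥c : C} {U : Tm → Set} {R₁ R₂ : Pair → Set₁} {a b x y q} → a ≈ b →
                 NFStep ⊥c U R₁ (a , x) → NFStep ⊥c U R₂ (b , y) → q ◃ (x , y) →
                 JointlyRelated R₁ R₂ q
  NFStep-child e (napp _ crnf₁ r₁ _) (napp _ crnf₂ r₂ _) appˡ =
    _ , _ , ≈-child (CRNF-unique-≈ e crnf₁ crnf₂) appˡ , r₁ , r₂
  NFStep-child e (napp _ crnf₁ _ r₁) (napp _ crnf₂ _ r₂) appʳ =
    _ , _ , ≈-child (CRNF-unique-≈ e crnf₁ crnf₂) appʳ , r₁ , r₂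
  NFStep-child e (nlam _ crnf₁ r₁) (nlam _ crnf₂ r₂) lamᵇ =
    _ , _ , ≈-child (CRNF-unique-≈ e crnf₁ crnf₂) lamᵇ , r₁ , r₂

lemma5p29 : {C : Set} (⊥c : C) (U : Term {C} → Set) →
            StronglyMeaningless ⊥c U →
            ∀ {t s₁ s₂} → t ⇝N[ ⊥c , U ] s₁ → t ⇝N[ ⊥c , U ] s₂ → s₁ ≈ s₂
lemma5p29 ⊥c U SM (R₁ , post₁ , r₁) (R₂ , post₂ , r₂) =
  ≈-coinduction (JointlyRelated R₁ R₂) head child (_ , _ , ≈-refl , r₁ , r₂)
  where
  open StronglyMeaningless SM using (meaningless)

  head : ∀ {p} → JointlyRelated R₁ R₂ p → SameHead p
  head {_ , _} (_ , _ , e , r , r′) = NFStep-sameHead meaningless e (post₁ r) (post₂ r′)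

  child : ∀ {p q} → JointlyRelated R₁ R₂ p → q ◃ p → JointlyRelated R₁ R₂ q
  child {_ , _} (_ , _ , e , r , r′) = NFStep-child e (post₁ r) (post₂ r′)
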